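{- Let $m\ge 2$, $r,s\ge 1$ be integers. For each pair $(i,j)$ with $i\in[m]$, $j\in[r]$, choose a vertex $v_{i,j,k_{i,j}} \in S_{i,j}$, and let $B = \{c\} \cup \{v_{i,j,k_{i,j}} : i\in[m], j\in[r]\}$. Then $V(Py(m,r,s)) \setminus B$ is a fort of $Py(m,r,s)$.
   Context: The peony graph $Py(m,r,s)$ has vertex set $\{c\} \cup \{u_i\}_{i=1}^m \cup \{v_{i,j,k} : i \in [m], j \in [r], k \in [s]\}$, where $[n]=\{1,\dots,n\}$ and indices $i$ are taken modulo $m$ (so $v_{0,j,k}=v_{m,j,k}$). Two distinct vertices $w,z$ are adjacent iff: $\{w,z\}=\{c,u_i\}$; $\{w,z\}=\{u_i,v_{i,j,1}\}$; $\{w,z\}=\{u_i,v_{i-1,j,s}\}$; or $\{w,z\}=\{v_{i,j,k},v_{i,j,k+1}\}$ with $k\in[s-1]$ (for some $i\in[m]$, $j\in[r]$). The layer $S_{i,j}$ is $\{v_{i,j,k}\}_{k=1}^s$. A set $S \subseteq V(G)$ is a fort of $G$ if every vertex $u \in V(G)\setminus S$ satisfies $|N_G(u)\cap S| \ne 1$, where $N_G(u)$ is the set of neighbors of $u$. -}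

module Defs where

open import Data.Nat using (ℕ; zero; suc)
open import Data.Fin using (Fin; toℕ)
open import Data.Product using (Σ; _×_; ∃)
open import Data.Sum using (_⊎_)
open import Relation.Binary.PropositionalEquality using (_≡_)
open import Relation.Nullary using (¬_)

-- Vertices of Py(m,r,s).  Indices are 0-based: i : Fin m stands for i+1 ∈ [m], etc.
data PyV (m r s : ℕ) : Set where
  c : PyV m r s
  u : Fin m → PyV m r s
  v : Fin m → Fin r → Fin s → PyV m r s

CycPred : (m : ℕ) → Fin m → Fin m → Set
CycPred m i' i = (suc (toℕ i') ≡ toℕ i) ⊎ ((toℕ i ≡ 0) × (suc (toℕ i') ≡ m))

-- the generating (unordered) edges, listed in one orientation
data PyEdge (m r s : ℕ) : PyV m r s → PyV m r s → Set where
  c-u    : ∀ i → PyEdge m r s c (u i)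
  u-first : ∀ i j k → toℕ k ≡ 0 → PyEdge m r s (u i) (v i j k)
  u-last  : ∀ i i' j k → CycPred m i' i → suc (toℕ k) ≡ s → PyEdge m r s (u i) (v i' j k)
  path   : ∀ i j k k' → suc (toℕ k) ≡ toℕ k' → PyEdge m r s (v i j k) (v i j k')

Adj : (m r s : ℕ) → PyV m r s → PyV m r s → Set
Adj m r s w z = PyEdge m r s w z ⊎ PyEdge m r s z w

OneNeighbourIn : (m r s : ℕ) → (PyV m r s → Set) → PyV m r s → Set
OneNeighbourIn m r s S x =
  Σ (PyV m r s) λ w → Adj m r s x w × S w × (∀ z → Adj m r s x z → S z → z ≡ w)

IsFort : (m r s : ℕ) → (PyV m r s → Set) → Set
IsFort m r s S = ∀ x → ¬ S x → ¬ OneNeighbourIn m r s S x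

BSet : (m r s : ℕ) → (Fin m → Fin r → Fin s) → PyV m r s → Set
BSet m r s k w = (w ≡ c) ⊎ (Σ (Fin m) λ i → Σ (Fin r) λ j → w ≡ v i j (k i j))

Compl : {A : Set} → (A → Set) → A → Set
Compl B w = ¬ B w

{-# OPTIONS --safe #-}
module Submission where

open import Defs
open import Data.Nat using (ℕ; _≤_; _<_; suc; s≤s; _<?_)
open import Data.Nat.Properties
  using (≤-antisym; ≮⇒≥; suc-injective; 1+n≢n; 1+n≢0; ≤-reflexive; <-irrefl; <-trans)
open import Data.Fin using (Fin; toℕ; fromℕ<; inject₁) renaming (zero to fzero; suc to fsuc)
open import Data.Fin.Properties using (toℕ<n; toℕ-fromℕ<; toℕ-inject₁) renaming (_≟_ to _≟ᶠ_)
open import Data.Product using (∃; _×_; _,_)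
open import Data.Sum using (_⊎_; inj₁; inj₂)
open import Function using (_∘_)
open import Relation.Nullary using (¬_; yes; no)
open import Relation.Nullary.Decidable using (decidable-stable)
open import Relation.Unary using (Decidable)
open import Relation.Binary.PropositionalEquality using (_≡_; _≢_; refl; sym; trans; cong)

-- Every vertex of B has two distinct neighbours: c sees u₁ and u₂, and v_{i,j,k} sees its
-- predecessor and successor on the path u_i, v_{i,j,1}, …, v_{i,j,s}, u_{i+1}, whose ends
-- differ because m ≥ 2.  B is an independent set, so both neighbours lie outside B.

last-or-next : ∀ {s} (k : Fin s) → suc (toℕ k) ≡ s ⊎ ∃ λ k′ → suc (toℕ k) ≡ toℕ k′
last-or-next {s} k with suc (toℕ k) <? s
... | yes k+1<s = inj₂ (fromℕ< k+1<s , sym (toℕ-fromℕ< k+1<s))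
... | no  k+1≮s = inj₁ (≤-antisym (toℕ<n k) (≮⇒≥ k+1≮s))

cycSuc : ∀ {m} (i : Fin m) → ∃ (CycPred m i)
cycSuc {suc _} i with last-or-next i
... | inj₁ last       = fzero , inj₂ (refl , last)
... | inj₂ (i′ , i+1) = i′ , inj₁ i+1

CycPred-irrefl : ∀ {m} {i : Fin m} → 2 ≤ m → ¬ CycPred m i i
CycPred-irrefl _                     (inj₁ i+1≡i)       = 1+n≢n i+1≡i
CycPred-irrefl (s≤s (s≤s {n = n} _)) (inj₂ (i≡0 , i+1≡m)) =
  1+n≢0 {n} (suc-injective (trans (sym i+1≡m) (cong suc i≡0)))

module _ {m r s : ℕ} where

  private
    V = PyV m r s

  distinct-neighbours⇒¬OneNeighbourIn : ∀ {S : V → Set} {x a b} → a ≢ b →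
    Adj m r s x a → S a → Adj m r s x b → S b → ¬ OneNeighbourIn m r s S x
  distinct-neighbours⇒¬OneNeighbourIn a≢b xa Sa xb Sb (w , _ , _ , unique) =
    a≢b (trans (unique _ xa Sa) (sym (unique _ xb Sb)))

  HasTwoNeighbours : V → Set
  HasTwoNeighbours x = ∃ λ a → ∃ λ b → a ≢ b × Adj m r s x a × Adj m r s x b

  c-hasTwoNeighbours : 2 ≤ m → HasTwoNeighbours c
  c-hasTwoNeighbours (s≤s (s≤s _)) =
    u fzero , u (fsuc fzero) , (λ ()) , inj₁ (c-u fzero) , inj₁ (c-u (fsuc fzero))

  module _ (i : Fin m) (j : Fin r) where

    BeforeOnStrand AfterOnStrand : Fin s → V → Set
    BeforeOnStrand k a = a ≡ u i ⊎ ∃ λ k′ → a ≡ v i j k′ × toℕ k′ < toℕ k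
    AfterOnStrand  k b =
      (∃ λ i′ → CycPred m i i′ × b ≡ u i′) ⊎ (∃ λ k′ → b ≡ v i j k′ × toℕ k < toℕ k′)

    before≢after : 2 ≤ m → ∀ {k a b} → BeforeOnStrand k a → AfterOnStrand k b → a ≢ b
    before≢after m≥2 (inj₁ refl) (inj₁ (_ , i→i , refl)) refl = CycPred-irrefl m≥2 i→i
    before≢after m≥2 (inj₂ (_ , refl , k′<k)) (inj₂ (_ , refl , k<k′)) refl =
      <-irrefl refl (<-trans k′<k k<k′)
    before≢after m≥2 (inj₁ refl) (inj₂ (_ , refl , _)) ()
    before≢after m≥2 (inj₂ (_ , refl , _)) (inj₁ (_ , _ , refl)) ()

    leftNeighbour : ∀ k → ∃ λ a → Adj m r s (v i j k) a × BeforeOnStrand k a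
    leftNeighbour fzero    = u i , inj₂ (u-first i j fzero refl) , inj₁ refl
    leftNeighbour (fsuc k) =
      v i j (inject₁ k) , inj₂ (path i j (inject₁ k) (fsuc k) k+1) ,
      inj₂ (inject₁ k , refl , ≤-reflexive k+1)
      where
      k+1 : suc (toℕ (inject₁ k)) ≡ suc (toℕ k)
      k+1 = cong suc (toℕ-inject₁ k)

    rightNeighbour : ∀ k → ∃ λ b → Adj m r s (v i j k) b × AfterOnStrand k b
    rightNeighbour k with last-or-next k
    ... | inj₁ last =
      let (i′ , i→i′) = cycSuc i in
      u i′ , inj₂ (u-last i′ i j k i→i′ last) , inj₁ (i′ , i→i′ , refl)
    ... | inj₂ (k′ , k+1) =
      v i j k′ , inj₁ (path i j k k′ k+1) , inj₂ (k′ , refl , ≤-reflexive k+1)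

    v-hasTwoNeighbours : 2 ≤ m → ∀ k → HasTwoNeighbours (v i j k)
    v-hasTwoNeighbours m≥2 k =
      let (a , xa , before) = leftNeighbour k
          (b , xb , after)  = rightNeighbour k
      in a , b , before≢after m≥2 before after , xa , xb

  module _ (k : Fin m → Fin r → Fin s) where

    private
      B = BSet m r s k

    u∉B : ∀ {i} → ¬ B (u i)
    u∉B (inj₁ ())
    u∉B (inj₂ (_ , _ , ()))

    v∈B⇒chosen : ∀ {i j l} → B (v i j l) → l ≡ k i j
    v∈B⇒chosen (inj₂ (_ , _ , refl)) = refl

    B? : Decidable B
    B? c         = yes (inj₁ refl)
    B? (u i)     = no u∉B
    B? (v i j l) with l ≟ᶠ k i j
    ... | yes refl = yes (inj₂ (i , j , refl))
    ... | no  l≢k  = no (l≢k ∘ v∈B⇒chosen)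

    edge-leaves-B : ∀ {x w} → PyEdge m r s x w → B x → ¬ B w
    edge-leaves-B (c-u _)               _  = u∉B
    edge-leaves-B (u-first _ _ _ _)     Bx = λ _ → u∉B Bx
    edge-leaves-B (u-last _ _ _ _ _ _)  Bx = λ _ → u∉B Bx
    edge-leaves-B (path i j l l′ l+1≡l′) Bx Bw
      with v∈B⇒chosen Bx | v∈B⇒chosen Bw
    ... | refl | refl = 1+n≢n l+1≡l′

    B-independent : ∀ {x w} → B x → Adj m r s x w → ¬ B w
    B-independent Bx (inj₁ xw) = edge-leaves-B xw Bx
    B-independent Bx (inj₂ wx) Bw = edge-leaves-B wx Bw Bx

    B-hasTwoNeighbours : 2 ≤ m → ∀ {x} → B x → HasTwoNeighbours x
    B-hasTwoNeighbours m≥2 (inj₁ refl)           = c-hasTwoNeighbours m≥2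
    B-hasTwoNeighbours m≥2 (inj₂ (i , j , refl)) = v-hasTwoNeighbours i j m≥2 (k i j)

claim4 : (m r s : ℕ) → 2 ≤ m → 1 ≤ r → 1 ≤ s →
    (k : Fin m → Fin r → Fin s) →
    IsFort m r s (Compl (BSet m r s k))
claim4 m r s m≥2 _ _ k x x∉S =
  let Bx                      = decidable-stable (B? k x) x∉S
      (a , b , a≢b , xa , xb) = B-hasTwoNeighbours k m≥2 Bx
  in distinct-neighbours⇒¬OneNeighbourIn a≢b
       xa (B-independent k Bx xa) xb (B-independent k Bx xb)
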